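{- Let $n,k$ be positive integers with $n\ge k$ and let $\tau$ be any positional marked pattern of length $k$. Then the polynomial $P_{n,\tau}(x)=\sum_{\sigma\in S_n}x^{pmp_\tau(\sigma)}$ has degree $n-k+1$, and its coefficient of $x^{n-k+1}$ equals $(n-k+1)!$.
   Context: A positional marked pattern of length $k$ is a permutation $\tau=\tau_1\cdots\tau_k$ of $[k]$ with exactly one entry underlined; $\pi(\tau)\in S_k$ is the permutation obtained by removing the underline and $u(\tau)$ is the position of the underlined entry. For a word $w$ with distinct letters, $red(w)$ replaces the $i$-th smallest letter by $i$. For $\sigma\in S_n$, $\sigma$ has a $\tau$-match at position $\ell$ if there are indices $i_1<\cdots<i_k$ with $i_{u(\tau)}=\ell$ and $red(\sigma_{i_1}\cdots\sigma_{i_k})=\pi(\tau)$; $pmp_\tau(\sigma)$ is the number of positions $\ell$ at which $\sigma$ has a $\tau$-match. -}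

module Defs where

open import Data.Nat using (ℕ; zero; suc; _≤_; _<?_; _∸_; _+_)
open import Data.Nat.Properties using (_≟_)
open import Data.List using (List; []; _∷_; [_]; map; filter; length; upTo; zip; drop; head; _++_)
open import Data.List.Relation.Unary.Any using (any?)
open import Data.List.Relation.Binary.Permutation.Propositional using (_↭_)
open import Data.Maybe using (Maybe; just)
open import Data.Product using (_×_; proj₁; proj₂)
open import Relation.Nullary.Decidable using (_×-dec_)
open import Relation.Binary.PropositionalEquality using (_≡_)
import Data.List.Properties as LP
import Data.Maybe.Properties as MP

range : ℕ → List ℕ
range n = map suc (upTo n)

-- red(w): replace the i-th smallest letter of w by i,
-- i.e. each letter x becomes 1 + #{letters of w smaller than x}.
red : List ℕ → List ℕ
red w = map (λ x → suc (length (filter (λ y → y <? x) w))) w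

subseqs : {A : Set} → ℕ → List A → List (List A)
subseqs zero    xs       = [ [] ]
subseqs (suc k) []       = []
subseqs (suc k) (x ∷ xs) = map (x ∷_) (subseqs k xs) ++ subseqs (suc k) xs

IsPerm : ℕ → List ℕ → Set
IsPerm n σ = σ ↭ range n

-- Positional marked pattern of length k: a permutation π of [k] with
-- the entry at position u (1 ≤ u ≤ k) underlined.
record MarkedPattern (k : ℕ) : Set where
  field
    π      : List ℕ
    π-perm : IsPerm k π
    u      : ℕ
    1≤u    : 1 ≤ u
    u≤k    : u ≤ k
open MarkedPattern public

-- position of the u-th entry (1-indexed) of a subsequence of (position, value) pairs
uthPos : ℕ → List (ℕ × ℕ) → Maybe ℕ
uthPos u s = head (drop (u ∸ 1) (map proj₁ s))

-- pmp_τ(σ): number of positions ℓ ∈ [n] (n = length σ) such that some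
-- subsequence σ_{i₁}⋯σ_{i_k} (i₁ < ⋯ < i_k) has i_{u(τ)} = ℓ and
-- red(σ_{i₁}⋯σ_{i_k}) = π(τ).
pmp : {k : ℕ} → MarkedPattern k → List ℕ → ℕ
pmp {k} τ σ = length (filter matchAt (range (length σ)))
  where
    indexed : List (ℕ × ℕ)
    indexed = zip (range (length σ)) σ
    matchAt : (ℓ : ℕ) → _
    matchAt ℓ = any? (λ s → LP.≡-dec _≟_ (red (map proj₂ s)) (π τ)
                             ×-dec MP.≡-dec _≟_ (uthPos (u τ) s) (just ℓ))
                     (subseqs k indexed)

-- σ contributes to the coefficient of x^j in P_{n,τ}(x) = Σ_{σ∈S_n} x^{pmp_τ(σ)}
Contributes : (n : ℕ) {k : ℕ} → MarkedPattern k → ℕ → List ℕ → Set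
Contributes n τ j σ = IsPerm n σ × pmp τ σ ≡ j

-- Let a be the underlined entry of τ, with p = u(τ) - 1 entries before it and q = k - u(τ)
-- after it, and put d = n - k, m = d + 1.  A match at position ℓ needs p letters before ℓ and
-- q after it, so matches only occur in the window of positions p + 1, …, p + m and
-- pmp_τ(σ) ≤ m.  Suppose σ = A ++ M ++ B (|A| = p, |M| = m) matches at every window position.
-- In the occurrence through a letter x of M, x has rank a, so a - 1 ≤ x - 1 letters of σ lie
-- below x and k - a ≤ n - x above it: M is an arrangement of a, …, a + d.  The occurrence
-- through a then contains all a - 1 letters of σ below a, and the one through a + d all
-- letters above a + d, so the low (high) letters of σ are those of π, in order (raised by d).
-- The occurrences through the first and last letters of M have prefix A and suffix B, which
-- splits these sequences correctly and gives A = expand π₁, B = expand π₂, where expand raises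
-- every value ≥ a by d.  Conversely every such σ matches at all m window positions, since
-- expand π₁ ++ x ∷ expand π₂ is order-isomorphic to π for each x ∈ [a, a + d].  So the
-- permutations with m matches are in bijection with the m! arrangements of [a, a + d].

module Submission where

open import Defs
open import Data.Nat using (ℕ; zero; suc; _+_; _*_; _∸_; _≤_; _<_; z≤n; s≤s; z<s; _<?_; _≤?_; _!)
open import Data.Nat.Properties
open import Data.List using (List; []; _∷_; [_]; _++_; map; filter; length; concatMap; applyUpTo; zip; head; drop)
open import Data.Maybe using (just)
open import Data.Maybe.Properties as Maybe using (just-injective)
open import Data.List.Properties using (length-++; length-map; map-++; filter-++; filter-all; filter-none; filter-reject; filter-accept; ∷-injectiveˡ; ∷-injectiveʳ; map-upTo; ++-assoc; ++-identityʳ; ++-cancelˡ; ++-cancelʳ; length-++-sucʳ; map-∘; map-cong; map-cong-local; map-id-local; filter-≐; ≡-dec)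
open import Data.List.Membership.Propositional using (_∈_; _∉_; find; lose)
open import Data.List.Membership.Propositional.Properties using (∈-++⁺ˡ; ∈-++⁺ʳ; ∈-++⁻; ∈-map⁺; ∈-map⁻; ∈-filter⁺; ∈-filter⁻; ∈-∃++; ∈-concatMap⁺; ∈-concatMap⁻)
open import Data.List.Relation.Unary.Any using (Any; here; there; any?)
open import Data.List.Relation.Unary.All as All using ([]; _∷_)
open import Data.List.Relation.Unary.AllPairs using ([]; _∷_)
open import Data.List.Relation.Unary.Unique.Propositional using (Unique)
import Data.List.Relation.Unary.Unique.Propositional.Properties as Unique
open import Data.List.Relation.Binary.Disjoint.Propositional using (Disjoint)
open import Data.List.Relation.Binary.Sublist.Propositional using (_⊆_; []; _∷_; _∷ʳ_; ⊆-refl)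
open import Data.List.Relation.Binary.Sublist.Propositional.Properties as Sublist using (length-mono-≤; to-≋; filter⁺; []⊆-universal)
open import Data.List.Relation.Binary.Equality.Propositional using (≋⇒≡)
open import Data.List.Relation.Binary.Permutation.Propositional using (_↭_; ↭-sym; ↭-trans; refl; prep; swap; ↭⇒↭ₛ)
open import Data.List.Relation.Binary.Permutation.Propositional.Properties using (↭-length; filter-↭; ∈-resp-↭; shift; drop-mid; ↭-empty-inv)
open import Data.Product using (Σ; ∃; ∃₂; _×_; _,_; proj₁; proj₂)
open import Data.Sum using (_⊎_; inj₁; inj₂)
open import Data.Bool using (true; false)
open import Data.Nat.Tactic.RingSolver using (solve-∀)
open import Function using (_∘_)
open import Function.Bundles using (_⇔_; mk⇔)
open import Relation.Nullary using (¬_; yes; no; does; contradiction; ¬?)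
open import Relation.Nullary.Decidable using (_×-dec_)
open import Relation.Unary using (Decidable)
open import Relation.Binary.PropositionalEquality using (_≡_; _≢_; refl; sym; trans; cong; cong₂; subst; subst₂; setoid; module ≡-Reasoning)
open import Relation.Binary.Core using (_Preserves_⟶_)
open import Relation.Binary.Definitions using (DecidableEquality; tri<; tri≈; tri>)
open import Data.List.Relation.Binary.Permutation.Setoid.Properties (setoid ℕ) using (Unique-resp-↭)

private variable
  A B : Set
  x : A
  xs ys : List A

-- Sublists, filters and counting

∈-subseqs⁺ : xs ⊆ ys → xs ∈ subseqs (length xs) ys
∈-subseqs⁺ []                      = here refl
∈-subseqs⁺ {xs = []}    (_ ∷ʳ _)   = here refl
∈-subseqs⁺ {xs = _ ∷ _} (y ∷ʳ p)   = ∈-++⁺ʳ (map (y ∷_) _) (∈-subseqs⁺ p)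
∈-subseqs⁺ (refl ∷ p)              = ∈-++⁺ˡ (∈-map⁺ _ (∈-subseqs⁺ p))

∈-subseqs⁻ : ∀ k → xs ∈ subseqs k ys → xs ⊆ ys × length xs ≡ k
∈-subseqs⁻ {ys = ys} zero (here refl) = []⊆-universal ys , refl
∈-subseqs⁻ {ys = y ∷ ys} (suc k) xs∈ with ∈-++⁻ (map (y ∷_) (subseqs k ys)) xs∈
... | inj₁ xs∈map with ∈-map⁻ (y ∷_) xs∈map
...   | _ , t∈ , refl = let t⊆ , len = ∈-subseqs⁻ k t∈ in refl ∷ t⊆ , cong suc len
∈-subseqs⁻ {ys = y ∷ ys} (suc k) xs∈ | inj₂ xs∈rest =
  let xs⊆ , len = ∈-subseqs⁻ (suc k) xs∈rest in y ∷ʳ xs⊆ , len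

⊆-length-≡ : xs ⊆ ys → length xs ≡ length ys → xs ≡ ys
⊆-length-≡ p eq = ≋⇒≡ (to-≋ eq p)

⊆-split : ∀ (ws : List A) {v vs ys} → ws ++ v ∷ vs ⊆ ys →
  ∃₂ λ ys₁ ys₂ → ys ≡ ys₁ ++ v ∷ ys₂ × ws ⊆ ys₁ × vs ⊆ ys₂
⊆-split []       (y ∷ʳ p)   = let ys₁ , ys₂ , eq , p₁ , p₂ = ⊆-split [] p in y ∷ ys₁ , ys₂ , cong (y ∷_) eq , y ∷ʳ p₁ , p₂
⊆-split []       (refl ∷ p) = [] , _ , refl , [] , p
⊆-split (w ∷ ws) (y ∷ʳ p)   = let ys₁ , ys₂ , eq , p₁ , p₂ = ⊆-split (w ∷ ws) p in y ∷ ys₁ , ys₂ , cong (y ∷_) eq , y ∷ʳ p₁ , p₂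
⊆-split (w ∷ ws) (refl ∷ p) = let ys₁ , ys₂ , eq , p₁ , p₂ = ⊆-split ws p in w ∷ ys₁ , ys₂ , cong (w ∷_) eq , refl ∷ p₁ , p₂

++-injective : ∀ (xs₁ : List A) {ys₁ xs₂ ys₂} → length xs₁ ≡ length xs₂ →
  xs₁ ++ ys₁ ≡ xs₂ ++ ys₂ → xs₁ ≡ xs₂ × ys₁ ≡ ys₂
++-injective []        {xs₂ = []}     _   eq = refl , eq
++-injective (x ∷ xs₁) {xs₂ = _ ∷ xs₂} len eq =
  let xs≡ , ys≡ = ++-injective xs₁ (suc-injective len) (∷-injectiveʳ eq)
  in cong₂ _∷_ (∷-injectiveˡ eq) xs≡ , ys≡

split-at : ∀ j (xs : List A) → j ≤ length xs → ∃₂ λ ys zs → xs ≡ ys ++ zs × length ys ≡ j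
split-at zero    xs       _         = [] , xs , refl , refl
split-at (suc j) (x ∷ xs) (s≤s j≤) =
  let ys , zs , eq , len = split-at j xs j≤ in x ∷ ys , zs , cong (x ∷_) eq , cong suc len

Unique-++⁻ : ∀ (xs : List A) {ys} → Unique (xs ++ ys) → Unique xs × Unique ys × Disjoint xs ys
Unique-++⁻ []       ys-unique          = [] , ys-unique , λ { (() , _) }
Unique-++⁻ (x ∷ xs) (x∉ ∷ xs++ys-unique) =
  let xs-unique , ys-unique , disjoint = Unique-++⁻ xs xs++ys-unique
  in All.tabulate (λ y∈ → All.lookup x∉ (∈-++⁺ˡ y∈)) ∷ xs-unique , ys-unique ,
     λ { (here refl , x∈ys) → All.lookup x∉ (∈-++⁺ʳ xs x∈ys) refl ; (there y∈xs , y∈ys) → disjoint (y∈xs , y∈ys) }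

split-around : ∀ i (xs : List A) → i < length xs → ∃₂ λ ys x → ∃ λ zs → xs ≡ ys ++ x ∷ zs × length ys ≡ i
split-around zero    (x ∷ xs) _         = [] , x , xs , refl , refl
split-around (suc i) (x ∷ xs) (s≤s i<) =
  let ys , y , zs , xs≡ , len = split-around i xs i< in x ∷ ys , y , zs , cong (x ∷_) xs≡ , cong suc len

map-≡-id⇒ : ∀ (h : A → A) {xs} → map h xs ≡ xs → x ∈ xs → h x ≡ x
map-≡-id⇒ h eq (here refl)  = ∷-injectiveˡ eq
map-≡-id⇒ h eq (there x∈xs) = map-≡-id⇒ h (∷-injectiveʳ eq) x∈xs

module _ {P : B → Set} (P? : Decidable P) where

  filter-map : ∀ (f : A → B) xs → filter P? (map f xs) ≡ map f (filter (λ x → P? (f x)) xs)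
  filter-map f []       = refl
  filter-map f (x ∷ xs) with does (P? (f x))
  ... | true  = cong (f x ∷_) (filter-map f xs)
  ... | false = filter-map f xs

module _ {P Q : A → Set} (P? : Decidable P) (Q? : Decidable Q) where

  filter-cong-local : ∀ {xs} → (∀ {x} → x ∈ xs → P x → Q x) → (∀ {x} → x ∈ xs → Q x → P x) →
    filter P? xs ≡ filter Q? xs
  filter-cong-local {[]}     _   _   = refl
  filter-cong-local {x ∷ xs} P⇒Q Q⇒P with P? x | Q? x
  ... | yes _  | yes _  = cong (x ∷_) (filter-cong-local (λ y∈ → P⇒Q (there y∈)) (λ y∈ → Q⇒P (there y∈)))
  ... | yes px | no ¬qx = contradiction (P⇒Q (here refl) px) ¬qx
  ... | no ¬px | yes qx = contradiction (Q⇒P (here refl) qx) ¬px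
  ... | no _   | no _   = filter-cong-local (λ y∈ → P⇒Q (there y∈)) (λ y∈ → Q⇒P (there y∈))

count : {P : A → Set} → Decidable P → List A → ℕ
count P? xs = length (filter P? xs)

module _ {P Q : A → Set} (P? : Decidable P) (Q? : Decidable Q) (P⇒Q : ∀ {x} → P x → Q x) where

  filter-⊆-filter : ∀ xs → filter P? xs ⊆ filter Q? xs
  filter-⊆-filter xs = filter⁺ P? Q? (λ { refl → P⇒Q }) (⊆-refl {x = xs})

  count-mono : ∀ xs → count P? xs ≤ count Q? xs
  count-mono xs = length-mono-≤ (filter-⊆-filter xs)

  count-≡⇒ : ∀ {xs} → count P? xs ≡ count Q? xs → x ∈ xs → Q x → P x
  count-≡⇒ {xs = xs} eq x∈ qx =
    proj₂ (∈-filter⁻ P? {xs = xs} (subst (_ ∈_) (sym (⊆-length-≡ (filter-⊆-filter xs) eq)) (∈-filter⁺ Q? x∈ qx)))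

  count-< : ∀ {xs} → x ∈ xs → Q x → ¬ P x → count P? xs < count Q? xs
  count-< {xs = xs} x∈ qx ¬px = ≤∧≢⇒< (count-mono xs) (λ eq → ¬px (count-≡⇒ eq x∈ qx))

  filter-filter : ∀ xs → filter P? (filter Q? xs) ≡ filter P? xs
  filter-filter []       = refl
  filter-filter (x ∷ xs) with Q? x
  ... | no ¬qx = trans (filter-filter xs) (sym (filter-reject P? (λ px → ¬qx (P⇒Q px))))
  ... | yes _ with P? x
  ...   | yes _ = cong (x ∷_) (filter-filter xs)
  ...   | no _  = filter-filter xs

module _ {P : A → Set} (P? : Decidable P) where

  filter-⊆ : ys ⊆ xs → filter P? ys ⊆ filter P? xs
  filter-⊆ = filter⁺ P? P? (λ { refl px → px })

  count-mono-⊆ : ys ⊆ xs → count P? ys ≤ count P? xs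
  count-mono-⊆ ys⊆xs = length-mono-≤ (filter-⊆ ys⊆xs)

  filter-≡-of-⊆ : ys ⊆ xs → count P? ys ≡ count P? xs → filter P? ys ≡ filter P? xs
  filter-≡-of-⊆ ys⊆xs = ⊆-length-≡ (filter-⊆ ys⊆xs)

  count-≡-of-filter : ∀ {R : A → Set} (R? : Decidable R) → (∀ {x} → R x → P x) →
    filter P? ys ≡ filter P? xs → count R? ys ≡ count R? xs
  count-≡-of-filter {ys = ys} {xs} R? R⇒P eq = begin
    count R? ys              ≡⟨ cong length (filter-filter R? P? R⇒P ys) ⟨
    count R? (filter P? ys)  ≡⟨ cong (count R?) eq ⟩
    count R? (filter P? xs)  ≡⟨ cong length (filter-filter R? P? R⇒P xs) ⟩
    count R? xs              ∎
    where open ≡-Reasoning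

-- Intervals of natural numbers

interval : ℕ → ℕ → List ℕ
interval b zero    = []
interval b (suc l) = b ∷ interval (suc b) l

length-interval : ∀ b l → length (interval b l) ≡ l
length-interval b zero    = refl
length-interval b (suc l) = cong suc (length-interval (suc b) l)

∈-interval⁻ : ∀ {v} b l → v ∈ interval b l → b ≤ v × v < b + l
∈-interval⁻ b (suc l) (here refl) = ≤-refl , m<m+n b z<s
∈-interval⁻ {v} b (suc l) (there v∈) =
  let b<v , v< = ∈-interval⁻ (suc b) l v∈ in <⇒≤ b<v , subst (v <_) (sym (+-suc b l)) v<

∈-interval⁺ : ∀ {v} b l → b ≤ v → v < b + l → v ∈ interval b l
∈-interval⁺ b zero    b≤v v< = contradiction b≤v (<⇒≱ (subst (_ <_) (+-identityʳ b) v<))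
∈-interval⁺ {v} b (suc l) b≤v v< with b ≟ v
... | yes refl = here refl
... | no  b≢v  = there (∈-interval⁺ (suc b) l (≤∧≢⇒< b≤v b≢v) (subst (v <_) (+-suc b l) v<))

interval-unique : ∀ b l → Unique (interval b l)
interval-unique b zero    = []
interval-unique b (suc l) =
  All.tabulate (λ v∈ b≡v → <-irrefl b≡v (proj₁ (∈-interval⁻ (suc b) l v∈))) ∷ interval-unique (suc b) l

interval-++ : ∀ b l₁ l₂ → interval b (l₁ + l₂) ≡ interval b l₁ ++ interval (b + l₁) l₂
interval-++ b zero     l₂ = cong (λ c → interval c l₂) (sym (+-identityʳ b))
interval-++ b (suc l₁) l₂ =
  cong (b ∷_) (trans (interval-++ (suc b) l₁ l₂) (cong (λ c → interval (suc b) l₁ ++ interval c l₂) (sym (+-suc b l₁))))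

applyUpTo-interval : ∀ (f : ℕ → ℕ) b l → (∀ i → f i ≡ b + i) → applyUpTo f l ≡ interval b l
applyUpTo-interval f b zero    _  = refl
applyUpTo-interval f b (suc l) eq =
  cong₂ _∷_ (trans (eq 0) (+-identityʳ b)) (applyUpTo-interval (λ i → f (suc i)) (suc b) l (λ i → trans (eq (suc i)) (+-suc b i)))

range-interval : ∀ n → range n ≡ interval 1 n
range-interval n = trans (map-upTo suc n) (applyUpTo-interval suc 1 n (λ _ → refl))

InRange : ℕ → ℕ → ℕ → Set
InRange c l v = c ≤ v × v < c + l

inRange? : ∀ c l → Decidable (InRange c l)
inRange? c l v = c ≤? v ×-dec v <? c + l

count-inRange : ∀ b l₁ l₂ l₃ → count (inRange? (b + l₁) l₂) (interval b (l₁ + l₂ + l₃)) ≡ l₂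
count-inRange b l₁ l₂ l₃ = begin
  count R? (interval b (l₁ + l₂ + l₃))
    ≡⟨ cong (count R?) (trans (interval-++ b (l₁ + l₂) l₃) (cong (_++ right) (interval-++ b l₁ l₂))) ⟩
  count R? ((left ++ middle) ++ right)
    ≡⟨ cong length (trans (filter-++ R? (left ++ middle) right) (cong (_++ filter R? right) (filter-++ R? left middle))) ⟩
  length ((filter R? left ++ filter R? middle) ++ filter R? right)
    ≡⟨ cong₂ (λ xs ys → length ((xs ++ filter R? middle) ++ ys)) (filter-none R? (All.tabulate left∉)) (filter-none R? (All.tabulate right∉)) ⟩
  length (filter R? middle ++ [])
    ≡⟨ cong length (trans (++-identityʳ _) (filter-all R? (All.tabulate middle∈))) ⟩
  length middle
    ≡⟨ length-interval (b + l₁) l₂ ⟩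
  l₂ ∎
  where
  open ≡-Reasoning
  R? = inRange? (b + l₁) l₂
  left middle right : List ℕ
  left   = interval b l₁
  middle = interval (b + l₁) l₂
  right  = interval (b + (l₁ + l₂)) l₃
  left∉ : ∀ {v} → v ∈ left → ¬ InRange (b + l₁) l₂ v
  left∉ v∈ (c≤v , _) = <⇒≱ (proj₂ (∈-interval⁻ b l₁ v∈)) c≤v
  middle∈ : ∀ {v} → v ∈ middle → InRange (b + l₁) l₂ v
  middle∈ = ∈-interval⁻ (b + l₁) l₂
  right∉ : ∀ {v} → v ∈ right → ¬ InRange (b + l₁) l₂ v
  right∉ v∈ (_ , v<) = <⇒≱ v< (≤-trans (≤-reflexive (+-assoc b l₁ l₂)) (proj₁ (∈-interval⁻ (b + (l₁ + l₂)) l₃ v∈)))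

count-interval : ∀ {P : ℕ → Set} (P? : Decidable P) b {N} l₁ l₂ l₃ → N ≡ l₁ + l₂ + l₃ →
  (∀ {v} → v ∈ interval b N → P v → InRange (b + l₁) l₂ v) →
  (∀ {v} → v ∈ interval b N → InRange (b + l₁) l₂ v → P v) →
  count P? (interval b N) ≡ l₂
count-interval P? b l₁ l₂ l₃ refl sound complete =
  trans (cong length (filter-cong-local P? (inRange? (b + l₁) l₂) sound complete)) (count-inRange b l₁ l₂ l₃)

-- Permutations of [n] and ranks of letters

below above : ℕ → List ℕ → ℕ
below v w = count (_<? v) w
above v w = count (v <?_) w

rank : List ℕ → ℕ → ℕ
rank w v = suc (below v w)

module _ {n : ℕ} {σ : List ℕ} (σ-perm : IsPerm n σ) where

  private
    σ↭interval : σ ↭ interval 1 n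
    σ↭interval = subst (σ ↭_) (range-interval n) σ-perm

    count-perm : ∀ {P : ℕ → Set} (P? : Decidable P) → count P? σ ≡ count P? (interval 1 n)
    count-perm P? = ↭-length (filter-↭ P? σ↭interval)

  perm-length : length σ ≡ n
  perm-length = trans (↭-length σ↭interval) (length-interval 1 n)

  perm-unique : Unique σ
  perm-unique = Unique-resp-↭ (↭⇒↭ₛ (↭-sym σ↭interval)) (interval-unique 1 n)

  perm-bounds : ∀ {x} → x ∈ σ → 1 ≤ x × x ≤ n
  perm-bounds x∈σ = let 1≤x , x<1+n = ∈-interval⁻ 1 n (∈-resp-↭ σ↭interval x∈σ) in 1≤x , ≤-pred x<1+n

  perm-below : ∀ {x} → x ∈ σ → below x σ ≡ x ∸ 1
  perm-below {x} x∈σ = trans (count-perm (_<? x))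
    (count-interval (_<? x) 1 0 (x ∸ 1) (n ∸ (x ∸ 1)) (sym (m+[n∸m]≡n (≤-trans (m∸n≤m x 1) x≤n)))
      (λ v∈ v<x → proj₁ (∈-interval⁻ 1 n v∈) , subst (_ <_) (sym 1+[x∸1]) v<x)
      (λ _ (_ , v<) → subst (_ <_) 1+[x∸1] v<))
    where
    1≤x = proj₁ (perm-bounds x∈σ)
    x≤n = proj₂ (perm-bounds x∈σ)
    1+[x∸1] : 1 + (x ∸ 1) ≡ x
    1+[x∸1] = m+[n∸m]≡n 1≤x

  perm-above : ∀ {x} → x ∈ σ → above x σ ≡ n ∸ x
  perm-above {x} x∈σ = trans (count-perm (x <?_))
    (count-interval (x <?_) 1 x (n ∸ x) 0 (sym (trans (+-identityʳ _) (m+[n∸m]≡n x≤n)))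
      (λ {v} v∈ x<v → x<v , subst (v <_) (cong suc (sym (m+[n∸m]≡n x≤n))) (proj₂ (∈-interval⁻ 1 n v∈)))
      (λ _ (x<v , _) → x<v))
    where
    x≤n = proj₂ (perm-bounds x∈σ)

∈-remove : ∀ (ys₁ : List A) {ys₂ x y} → y ∈ ys₁ ++ x ∷ ys₂ → y ≢ x → y ∈ ys₁ ++ ys₂
∈-remove []        (here y≡x) y≢x = contradiction y≡x y≢x
∈-remove []        (there y∈) _   = y∈
∈-remove (_ ∷ ys₁) (here y≡z) _   = here y≡z
∈-remove (_ ∷ ys₁) (there y∈) y≢x = there (∈-remove ys₁ y∈ y≢x)

↭-of-⊆ : ∀ (xs : List A) {ys} → Unique xs → length xs ≡ length ys → (∀ {x} → x ∈ xs → x ∈ ys) → xs ↭ ys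
↭-of-⊆ []       {[]} _ _ _ = refl
↭-of-⊆ (x ∷ xs) (x∉xs ∷ xs-unique) len xs⊆ys with ∈-∃++ (xs⊆ys (here refl))
... | ys₁ , ys₂ , refl = ↭-trans (prep x (↭-of-⊆ xs xs-unique len′ xs⊆ys₁++ys₂)) (↭-sym (shift x ys₁ ys₂))
  where
  len′ : length xs ≡ length (ys₁ ++ ys₂)
  len′ = suc-injective (trans len (length-++-sucʳ ys₁ x ys₂))
  xs⊆ys₁++ys₂ : ∀ {y} → y ∈ xs → y ∈ ys₁ ++ ys₂
  xs⊆ys₁++ys₂ y∈ = ∈-remove ys₁ (xs⊆ys (there y∈)) (λ y≡x → All.lookup x∉xs y∈ (sym y≡x))

perm-intro : ∀ n {σ} → Unique σ → length σ ≡ n → (∀ {x} → x ∈ σ → 1 ≤ x × x ≤ n) → IsPerm n σ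
perm-intro n {σ} σ-unique len bounds = subst (σ ↭_) (sym (range-interval n))
  (↭-of-⊆ σ σ-unique (trans len (sym (length-interval 1 n)))
    (λ x∈ → let 1≤x , x≤n = bounds x∈ in ∈-interval⁺ 1 n 1≤x (s≤s x≤n)))

module _ (w : List ℕ) where

  rank-mono : ∀ {x v} → x ∈ w → x < v → rank w x < rank w v
  rank-mono x∈w x<v = s≤s (count-< (_<? _) (_<? _) (λ y<x → <-trans y<x x<v) x∈w x<v (<-irrefl refl))

  rank-reflect : ∀ {x v} → rank w x < rank w v → x < v
  rank-reflect {x} {v} r< with x <? v
  ... | yes x<v = x<v
  ... | no  x≮v = contradiction r< (≤⇒≯ (s≤s (count-mono (_<? v) (_<? x) (λ y<v → <-≤-trans y<v (≮⇒≥ x≮v)) w)))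

  above-rank : ∀ {v} → v ∈ w → above (rank w v) (red w) ≡ above v w
  above-rank {v} v∈w = begin
    count (rank w v <?_) (map (rank w) w)
      ≡⟨ cong length (filter-map (rank w v <?_) (rank w) w) ⟩
    length (map (rank w) (filter (λ y → rank w v <? rank w y) w))
      ≡⟨ length-map (rank w) (filter (λ y → rank w v <? rank w y) w) ⟩
    count (λ y → rank w v <? rank w y) w
      ≡⟨ cong length (filter-cong-local (λ y → rank w v <? rank w y) (v <?_) {w} (λ _ → rank-reflect) (λ _ → rank-mono v∈w)) ⟩
    above v w ∎
    where open ≡-Reasoning

module _ {g : ℕ → ℕ} (g-mono : g Preserves _<_ ⟶ _<_) where

  strictMono-reflect : ∀ {x y} → g x < g y → x < y
  strictMono-reflect {x} {y} gx<gy with <-cmp x y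
  ... | tri< x<y _ _ = x<y
  ... | tri≈ _ refl _ = contradiction gx<gy (<-irrefl refl)
  ... | tri> _ _ y<x = contradiction gx<gy (<-asym (g-mono y<x))

  strictMono-injective : ∀ {x y} → g x ≡ g y → x ≡ y
  strictMono-injective {x} {y} gx≡gy with <-cmp x y
  ... | tri< x<y _ _ = contradiction gx≡gy (<⇒≢ (g-mono x<y))
  ... | tri≈ _ x≡y _ = x≡y
  ... | tri> _ _ y<x = contradiction (sym gx≡gy) (<⇒≢ (g-mono y<x))

  red-map-strictMono : ∀ w → red (map g w) ≡ red w
  red-map-strictMono w = trans (sym (map-∘ w)) (map-cong rank-g w)
    where
    rank-g : ∀ v → rank (map g w) (g v) ≡ rank w v
    rank-g v = cong suc (begin
      count (_<? g v) (map g w)                      ≡⟨ cong length (filter-map (_<? g v) g w) ⟩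
      length (map g (filter (λ y → g y <? g v) w))   ≡⟨ length-map g (filter (λ y → g y <? g v) w) ⟩
      count (λ y → g y <? g v) w                     ≡⟨ cong length (filter-≐ _ _ (strictMono-reflect , g-mono) w) ⟩
      below v w                                      ∎)
      where open ≡-Reasoning

red-perm : ∀ {k π} → IsPerm k π → red π ≡ π
red-perm π-perm = map-id-local (All.tabulate λ v∈ →
  trans (cong suc (perm-below π-perm v∈)) (m+[n∸m]≡n (proj₁ (perm-bounds π-perm v∈))))

-- The list of all rearrangements of a list

insertions : A → List A → List (List A)
insertions x []       = [ [ x ] ]
insertions x (y ∷ ys) = (x ∷ y ∷ ys) ∷ map (y ∷_) (insertions x ys)

permutations : List A → List (List A)
permutations []       = [ [] ]
permutations (x ∷ xs) = concatMap (insertions x) (permutations xs)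

length-insertions : ∀ (x : A) ys → length (insertions x ys) ≡ suc (length ys)
length-insertions x []       = refl
length-insertions x (y ∷ ys) = cong suc (trans (length-map (y ∷_) (insertions x ys)) (length-insertions x ys))

∈-insertions⁻ : ∀ {x : A} ys {zs} → zs ∈ insertions x ys → zs ↭ x ∷ ys
∈-insertions⁻ []       (here refl) = refl
∈-insertions⁻ (y ∷ ys) (here refl) = refl
∈-insertions⁻ (y ∷ ys) (there zs∈) with ∈-map⁻ (y ∷_) zs∈
... | _ , zs′∈ , refl = ↭-trans (prep y (∈-insertions⁻ ys zs′∈)) (swap y _ refl)

∈-insertions⁺ : ∀ (x : A) ys₁ ys₂ → ys₁ ++ x ∷ ys₂ ∈ insertions x (ys₁ ++ ys₂)
∈-insertions⁺ x []        []       = here refl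
∈-insertions⁺ x []        (_ ∷ _)  = here refl
∈-insertions⁺ x (y ∷ ys₁) ys₂      = there (∈-map⁺ (y ∷_) (∈-insertions⁺ x ys₁ ys₂))

∈-permutations⁻ : ∀ (xs : List A) {ys} → ys ∈ permutations xs → ys ↭ xs
∈-permutations⁻ []       (here refl) = refl
∈-permutations⁻ (x ∷ xs) ys∈ =
  let zs , zs∈ , ys∈′ = find (∈-concatMap⁻ (insertions x) {xs = permutations xs} ys∈)
  in ↭-trans (∈-insertions⁻ zs ys∈′) (prep x (∈-permutations⁻ xs zs∈))

∈-permutations⁺ : ∀ (xs : List A) {ys} → ys ↭ xs → ys ∈ permutations xs
∈-permutations⁺ []       ys↭ with refl ← ↭-empty-inv ys↭ = here refl
∈-permutations⁺ (x ∷ xs) ys↭ with ∈-∃++ (∈-resp-↭ (↭-sym ys↭) (here refl))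
... | ys₁ , ys₂ , refl = ∈-concatMap⁺ (insertions x) (lose (∈-permutations⁺ xs (drop-mid ys₁ [] ys↭)) (∈-insertions⁺ x ys₁ ys₂))

length-permutations : ∀ (xs : List A) → length (permutations xs) ≡ length xs !
length-permutations []       = refl
length-permutations (x ∷ xs) = begin
  length (concatMap (insertions x) (permutations xs)) ≡⟨ length-concatMap (permutations xs) (λ ys∈ → ↭-length (∈-permutations⁻ xs ys∈)) ⟩
  length (permutations xs) * suc (length xs)          ≡⟨ cong (_* suc (length xs)) (length-permutations xs) ⟩
  length xs ! * suc (length xs)                       ≡⟨ *-comm (length xs !) (suc (length xs)) ⟩
  suc (length xs) !                                   ∎
  where
  open ≡-Reasoning
  length-concatMap : ∀ L → (∀ {ys} → ys ∈ L → length ys ≡ length xs) →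
    length (concatMap (insertions x) L) ≡ length L * suc (length xs)
  length-concatMap []       _   = refl
  length-concatMap (ys ∷ L) len = begin
    length (insertions x ys ++ concatMap (insertions x) L)            ≡⟨ length-++ (insertions x ys) ⟩
    length (insertions x ys) + length (concatMap (insertions x) L)   ≡⟨ cong₂ _+_ (trans (length-insertions x ys) (cong suc (len (here refl)))) (length-concatMap L (λ ys∈ → len (there ys∈))) ⟩
    suc (length xs) + length L * suc (length xs)                     ∎

module _ {A : Set} (_≟_ : DecidableEquality A) where

  private
    _≢?_ : ∀ (x : A) → Decidable (_≢ x)
    _≢?_ x y = ¬? (y ≟ x)

  filter-insertions : ∀ {x} ys {zs} → x ∉ ys → zs ∈ insertions x ys → filter (x ≢?_) zs ≡ ys
  filter-insertions []       _    (here refl) = filter-reject (_ ≢?_) (λ x≢x → x≢x refl)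
  filter-insertions (y ∷ ys) x∉ys (here refl) =
    trans (filter-reject (_ ≢?_) (λ x≢x → x≢x refl))
          (filter-all (_ ≢?_) (All.tabulate (λ z∈ z≡x → x∉ys (subst (_∈ y ∷ ys) z≡x z∈))))
  filter-insertions (y ∷ ys) x∉ys (there zs∈) with ∈-map⁻ (y ∷_) zs∈
  ... | zs , zs∈′ , refl =
    trans (filter-accept (_ ≢?_) (λ y≡x → x∉ys (here (sym y≡x))))
          (cong (y ∷_) (filter-insertions ys (λ x∈ys → x∉ys (there x∈ys)) zs∈′))

  insertions-unique : ∀ {x : A} ys → x ∉ ys → Unique (insertions x ys)
  insertions-unique []       _    = [] ∷ []
  insertions-unique (y ∷ ys) x∉ys =
    All.tabulate (λ zs∈ eq → let _ , _ , zs≡ = ∈-map⁻ (y ∷_) zs∈ in x∉ys (here (∷-injectiveˡ (trans eq zs≡))))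
    ∷ Unique.map⁺ ∷-injectiveʳ (insertions-unique ys (λ x∈ys → x∉ys (there x∈ys)))

  permutations-unique : ∀ {xs : List A} → Unique xs → Unique (permutations xs)
  permutations-unique {[]}     _                  = [] ∷ []
  permutations-unique {x ∷ xs} (x∉xs ∷ xs-unique) = concatMap-unique (permutations xs) x∉ (permutations-unique xs-unique)
    where
    x∉ : ∀ {ys} → ys ∈ permutations xs → x ∉ ys
    x∉ ys∈ x∈ys = All.lookup x∉xs (∈-resp-↭ (∈-permutations⁻ xs ys∈) x∈ys) refl
    concatMap-unique : ∀ L → (∀ {ys} → ys ∈ L → x ∉ ys) → Unique L → Unique (concatMap (insertions x) L)
    concatMap-unique []       _   _                = []
    concatMap-unique (ys ∷ L) x∉L (ys∉L ∷ L-unique) =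
      Unique.++⁺ (insertions-unique ys (x∉L (here refl))) (concatMap-unique L (λ ys∈ → x∉L (there ys∈)) L-unique) disjoint
      where
      disjoint : Disjoint (insertions x ys) (concatMap (insertions x) L)
      disjoint (zs∈ , zs∈L) =
        let ys′ , ys′∈ , zs∈′ = find (∈-concatMap⁻ (insertions x) {xs = L} zs∈L)
        in All.lookup ys∉L ys′∈ (trans (sym (filter-insertions ys (x∉L (here refl)) zs∈))
                                        (filter-insertions ys′ (x∉L (there ys′∈)) zs∈′))

-- Occurrences of a marked pattern

head-drop-map⁻ : ∀ (f : A → B) j (s : List A) {y} → head (drop j (map f s)) ≡ just y →
  ∃₂ λ s₁ e → ∃ λ s₂ → s ≡ s₁ ++ e ∷ s₂ × length s₁ ≡ j × f e ≡ y
head-drop-map⁻ f zero    (e ∷ s) eq = [] , e , s , refl , refl , just-injective eq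
head-drop-map⁻ f (suc j) (e ∷ s) eq =
  let s₁ , e′ , s₂ , s≡ , len , fe′ = head-drop-map⁻ f j s eq in e ∷ s₁ , e′ , s₂ , cong (e ∷_) s≡ , cong suc len , fe′

head-drop-map⁺ : ∀ (f : A → B) s₁ {e s₂} → head (drop (length s₁) (map f (s₁ ++ e ∷ s₂))) ≡ just (f e)
head-drop-map⁺ f []       = refl
head-drop-map⁺ f (_ ∷ s₁) = head-drop-map⁺ f s₁

indexed : ℕ → List ℕ → List (ℕ × ℕ)
indexed b σ = zip (interval b (length σ)) σ

map-proj₂-indexed : ∀ b σ → map proj₂ (indexed b σ) ≡ σ
map-proj₂-indexed b []      = refl
map-proj₂-indexed b (x ∷ σ) = cong (x ∷_) (map-proj₂-indexed (suc b) σ)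

indexed-++ : ∀ b σ₁ {v σ₂} →
  indexed b (σ₁ ++ v ∷ σ₂) ≡ indexed b σ₁ ++ (b + length σ₁ , v) ∷ indexed (suc (b + length σ₁)) σ₂
indexed-++ b [] {v} {σ₂} = cong (λ c → (c , v) ∷ indexed (suc c) σ₂) (sym (+-identityʳ b))
indexed-++ b (x ∷ σ₁) {v} {σ₂} = cong ((b , x) ∷_) (trans (indexed-++ (suc b) σ₁)
  (cong (λ c → indexed (suc b) σ₁ ++ (c , v) ∷ indexed (suc c) σ₂) (sym (+-suc b (length σ₁)))))

indexed-position : ∀ b σ L₁ {e L₂} → indexed b σ ≡ L₁ ++ e ∷ L₂ → proj₁ e ≡ b + length L₁
indexed-position b (x ∷ σ) []       eq = trans (sym (cong proj₁ (∷-injectiveˡ eq))) (sym (+-identityʳ b))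
indexed-position b (x ∷ σ) (_ ∷ L₁) eq =
  trans (indexed-position (suc b) σ L₁ (∷-injectiveʳ eq)) (sym (+-suc b (length L₁)))

⊆-indexed : ∀ b {w σ} → w ⊆ σ → ∃ λ t → t ⊆ indexed b σ × map proj₂ t ≡ w
⊆-indexed b []         = [] , [] , refl
⊆-indexed b (_ ∷ʳ p)   = let t , t⊆ , t≡ = ⊆-indexed (suc b) p in t , _ ∷ʳ t⊆ , t≡
⊆-indexed b (refl ∷ p) = let t , t⊆ , t≡ = ⊆-indexed (suc b) p in _ ∷ t , refl ∷ t⊆ , cong (_ ∷_) t≡

zip-range : ∀ σ → zip (range (length σ)) σ ≡ indexed 1 σ
zip-range σ = cong (λ r → zip r σ) (range-interval (length σ))

module _ {k : ℕ} (τ : MarkedPattern k) where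

  record Occurrence (σ : List ℕ) (ℓ : ℕ) : Set where
    constructor occurrence
    field
      before        : List ℕ
      letter        : ℕ
      after         : List ℕ
      prefix suffix : List ℕ
      σ-split       : σ ≡ before ++ letter ∷ after
      position      : suc (length before) ≡ ℓ
      prefix⊆       : prefix ⊆ before
      suffix⊆       : suffix ⊆ after
      length-prefix : length prefix ≡ u τ ∸ 1
      red-word      : red (prefix ++ letter ∷ suffix) ≡ π τ

  length-of-red≡π : ∀ {w} → red w ≡ π τ → length w ≡ k
  length-of-red≡π {w} red≡π = trans (sym (length-map (rank w) w)) (trans (cong length red≡π) (perm-length (π-perm τ)))

  MatchAt : List ℕ → ℕ → Set
  MatchAt σ ℓ = Any (λ s → red (map proj₂ s) ≡ π τ × uthPos (u τ) s ≡ just ℓ) (subseqs k (zip (range (length σ)) σ))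

  matchAt? : ∀ σ → Decidable (MatchAt σ)
  matchAt? σ ℓ = any? (λ s → ≡-dec _≟_ (red (map proj₂ s)) (π τ) ×-dec Maybe.≡-dec _≟_ (uthPos (u τ) s) (just ℓ))
                      (subseqs k (zip (range (length σ)) σ))

  pmp≡count : ∀ σ → pmp τ σ ≡ count (matchAt? σ) (interval 1 (length σ))
  pmp≡count σ = cong (count (matchAt? σ)) (range-interval (length σ))

  match⇒occurrence : ∀ {σ ℓ} → MatchAt σ ℓ → Occurrence σ ℓ
  match⇒occurrence {σ} {ℓ} match with find match
  ... | s , s∈ , red-s , pos-s with head-drop-map⁻ proj₁ (u τ ∸ 1) s pos-s
  ... | s₁ , e , s₂ , refl , length-s₁ , e≡ℓ with ⊆-split s₁ (subst (_ ⊆_) (zip-range σ) (proj₁ (∈-subseqs⁻ k s∈)))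
  ... | L₁ , L₂ , indexed≡ , s₁⊆ , s₂⊆ =
    occurrence (map proj₂ L₁) (proj₂ e) (map proj₂ L₂) (map proj₂ s₁) (map proj₂ s₂)
      (trans (sym (map-proj₂-indexed 1 σ)) (trans (cong (map proj₂) indexed≡) (map-++ proj₂ L₁ (e ∷ L₂))))
      (trans (cong suc (length-map proj₂ L₁)) (trans (sym (indexed-position 1 σ L₁ indexed≡)) e≡ℓ))
      (Sublist.map⁺ proj₂ s₁⊆) (Sublist.map⁺ proj₂ s₂⊆)
      (trans (length-map proj₂ s₁) length-s₁)
      (trans (cong red (sym (map-++ proj₂ s₁ (e ∷ s₂)))) red-s)

  occurrence⇒match : ∀ {σ ℓ} → Occurrence σ ℓ → MatchAt σ ℓ
  occurrence⇒match (occurrence σ₁ v σ₂ w₁ w₂ refl refl w₁⊆ w₂⊆ length-w₁ red-w) = lose s∈ (red-s , pos-s)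
    where
    t₁ = proj₁ (⊆-indexed 1 w₁⊆)
    t₂ = proj₁ (⊆-indexed (2 + length σ₁) w₂⊆)
    s = t₁ ++ (1 + length σ₁ , v) ∷ t₂
    proj₂-s : map proj₂ s ≡ w₁ ++ v ∷ w₂
    proj₂-s = trans (map-++ proj₂ t₁ _)
      (cong₂ (λ xs ys → xs ++ v ∷ ys) (proj₂ (proj₂ (⊆-indexed 1 w₁⊆))) (proj₂ (proj₂ (⊆-indexed (2 + length σ₁) w₂⊆))))
    s⊆ : s ⊆ indexed 1 (σ₁ ++ v ∷ σ₂)
    s⊆ = subst (s ⊆_) (sym (indexed-++ 1 σ₁))
      (Sublist.++⁺ (proj₁ (proj₂ (⊆-indexed 1 w₁⊆))) (refl ∷ proj₁ (proj₂ (⊆-indexed (2 + length σ₁) w₂⊆))))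
    red-s : red (map proj₂ s) ≡ π τ
    red-s = trans (cong red proj₂-s) red-w
    s∈ : s ∈ subseqs k (zip (range (length (σ₁ ++ v ∷ σ₂))) (σ₁ ++ v ∷ σ₂))
    s∈ = subst₂ (λ j xs → s ∈ subseqs j xs)
      (trans (sym (length-map proj₂ s)) (trans (cong length proj₂-s) (length-of-red≡π red-w)))
      (sym (zip-range (σ₁ ++ v ∷ σ₂))) (∈-subseqs⁺ s⊆)
    pos-s : uthPos (u τ) s ≡ just (suc (length σ₁))
    pos-s = subst (λ j → head (drop j (map proj₁ s)) ≡ just (suc (length σ₁)))
      (trans (sym (length-map proj₂ t₁)) (trans (cong length (proj₂ (proj₂ (⊆-indexed 1 w₁⊆)))) length-w₁))
      (head-drop-map⁺ proj₁ t₁)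

-- The coefficient of x^(n-k+1)

module LeadingTerm {k : ℕ} (τ : MarkedPattern k) (π₁ : List ℕ) (a : ℕ) (π₂ : List ℕ) (n d : ℕ)
  (π-split : π τ ≡ π₁ ++ a ∷ π₂) (u-position : u τ ≡ suc (length π₁)) (k+d≡n : k + d ≡ n) where

  p q m : ℕ
  p = length π₁
  q = length π₂
  m = d + 1

  π-perm′ : IsPerm k (π₁ ++ a ∷ π₂)
  π-perm′ = subst (IsPerm k) π-split (π-perm τ)

  k≡ : k ≡ p + suc q
  k≡ = trans (sym (perm-length π-perm′)) (length-++ π₁)

  n≡ : n ≡ p + m + q
  n≡ = trans (sym k+d≡n) (trans (cong (_+ d) k≡) (arith p q d))
    where
    arith : ∀ p q d → p + suc q + d ≡ p + (d + 1) + q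
    arith = solve-∀

  u∸1≡p : u τ ∸ 1 ≡ p
  u∸1≡p = cong (_∸ 1) u-position

  a+m≡ : a + m ≡ suc (a + d)
  a+m≡ = trans (sym (+-assoc a d 1)) (+-comm (a + d) 1)

  a-bounds : 1 ≤ a × a ≤ k
  a-bounds = perm-bounds π-perm′ (∈-++⁺ʳ π₁ (here refl))

  private
    π-parts : Unique π₁ × Unique (a ∷ π₂) × Disjoint π₁ (a ∷ π₂)
    π-parts = Unique-++⁻ π₁ (perm-unique π-perm′)

  π₁-unique : Unique π₁
  π₁-unique = proj₁ π-parts

  π₂-unique : Unique π₂
  π₂-unique with _ ∷ π₂-unique ← proj₁ (proj₂ π-parts) = π₂-unique

  π₁∌a : ∀ {v} → v ∈ π₁ → v ≢ a
  π₁∌a v∈ refl = proj₂ (proj₂ π-parts) (v∈ , here refl)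

  π₂∌a : ∀ {v} → v ∈ π₂ → v ≢ a
  π₂∌a v∈ refl with a∉π₂ ∷ _ ← proj₁ (proj₂ π-parts) = All.lookup a∉π₂ v∈ refl

  π₁∩π₂ : Disjoint π₁ π₂
  π₁∩π₂ (v∈π₁ , v∈π₂) = proj₂ (proj₂ π-parts) (v∈π₁ , there v∈π₂)

  Outside : ℕ → Set
  Outside x = x < a ⊎ a + d < x

  expand : ℕ → ℕ
  expand v with v <? a
  ... | yes _ = v
  ... | no  _ = v + d

  expand-low : ∀ {v} → v < a → expand v ≡ v
  expand-low {v} v<a with v <? a
  ... | yes _   = refl
  ... | no  v≮a = contradiction v<a v≮a

  expand-high : ∀ {v} → ¬ v < a → expand v ≡ v + d
  expand-high {v} v≮a with v <? a
  ... | yes v<a = contradiction v<a v≮a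
  ... | no  _   = refl

  expand-mono : expand Preserves _<_ ⟶ _<_
  expand-mono {v} {v′} v<v′ with v <? a | v′ <? a
  ... | yes _   | yes _    = v<v′
  ... | yes v<a | no  v′≮a = <-≤-trans v<a (≤-trans (≮⇒≥ v′≮a) (m≤m+n v′ d))
  ... | no  v≮a | yes v′<a = contradiction (<-trans v<v′ v′<a) v≮a
  ... | no  _   | no  _    = +-monoˡ-< d v<v′

  expand-outside : ∀ {v} → v ≢ a → Outside (expand v)
  expand-outside {v} v≢a with v <? a
  ... | yes v<a = inj₁ v<a
  ... | no  v≮a = inj₂ (+-monoˡ-< d (≤∧≢⇒< (≮⇒≥ v≮a) (λ a≡v → v≢a (sym a≡v))))

  module _ {x : ℕ} (a≤x : a ≤ x) (x≤a+d : x ≤ a + d) where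

    place : ℕ → ℕ
    place v with v ≟ a
    ... | yes _ = x
    ... | no  _ = expand v

    place-a : place a ≡ x
    place-a with a ≟ a
    ... | yes _   = refl
    ... | no  a≢a = contradiction refl a≢a

    place-≢a : ∀ {v} → v ≢ a → place v ≡ expand v
    place-≢a {v} v≢a with v ≟ a
    ... | yes v≡a = contradiction v≡a v≢a
    ... | no  _   = refl

    place-mono : place Preserves _<_ ⟶ _<_
    place-mono {v} {v′} v<v′ with v ≟ a | v′ ≟ a
    ... | yes refl | yes refl = contradiction v<v′ (<-irrefl refl)
    ... | yes refl | no  _    = <-≤-trans (s≤s x≤a+d) (≤-trans (+-monoˡ-≤ d v<v′) (≤-reflexive (sym (expand-high (<⇒≯ v<v′)))))
    ... | no  _    | yes refl = <-≤-trans (subst (_< a) (sym (expand-low v<v′)) v<v′) a≤x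
    ... | no  _    | no  _    = expand-mono v<v′

    red-frame : red (map expand π₁ ++ x ∷ map expand π₂) ≡ π τ
    red-frame = begin
      red (map expand π₁ ++ x ∷ map expand π₂)  ≡⟨ cong red framed≡ ⟨
      red (map place (π₁ ++ a ∷ π₂))             ≡⟨ red-map-strictMono place-mono (π₁ ++ a ∷ π₂) ⟩
      red (π₁ ++ a ∷ π₂)                         ≡⟨ red-perm π-perm′ ⟩
      π₁ ++ a ∷ π₂                               ≡⟨ π-split ⟨
      π τ                                        ∎
      where
      open ≡-Reasoning
      framed≡ : map place (π₁ ++ a ∷ π₂) ≡ map expand π₁ ++ x ∷ map expand π₂
      framed≡ = trans (map-++ place π₁ (a ∷ π₂)) (cong₂ _++_
        (map-cong-local (All.tabulate (λ v∈ → place-≢a (π₁∌a v∈))))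
        (cong₂ _∷_ place-a (map-cong-local (All.tabulate (λ v∈ → place-≢a (π₂∌a v∈))))))

  window : List ℕ
  window = interval a m

  ∈-window⁻ : ∀ {x} → x ∈ window → a ≤ x × x ≤ a + d
  ∈-window⁻ {x} x∈ = let a≤x , x< = ∈-interval⁻ a m x∈ in a≤x , ≤-pred (subst (x <_) a+m≡ x<)

  ∈-window⁺ : ∀ {x} → a ≤ x → x ≤ a + d → x ∈ window
  ∈-window⁺ {x} a≤x x≤a+d = ∈-interval⁺ a m a≤x (subst (x <_) (sym a+m≡) (s≤s x≤a+d))

  frame : List ℕ → List ℕ
  frame M = map expand π₁ ++ M ++ map expand π₂

  candidates : List (List ℕ)
  candidates = map frame (permutations window)

  candidates-unique : Unique candidates
  candidates-unique = Unique.map⁺ frame-injective (permutations-unique _≟_ (interval-unique a m))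
    where
    frame-injective : ∀ {M M′} → frame M ≡ frame M′ → M ≡ M′
    frame-injective eq = ++-cancelʳ (map expand π₂) _ _ (++-cancelˡ (map expand π₁) _ _ eq)

  length-candidates : length candidates ≡ m !
  length-candidates = trans (length-map frame (permutations window))
    (trans (length-permutations window) (cong _! (length-interval a m)))

  InWindow : ℕ → Set
  InWindow = InRange (suc p) m

  occurrence-inWindow : ∀ {σ ℓ} → length σ ≡ n → Occurrence τ σ ℓ → InWindow ℓ
  occurrence-inWindow {σ} {ℓ} length-σ (occurrence σ₁ v σ₂ w₁ w₂ refl refl w₁⊆ w₂⊆ length-w₁ red-w) =
    s≤s p≤ , s≤s (+-cancelʳ-≤ q (suc (length σ₁)) (p + m) ℓ+q≤)
    where
    p≤ : p ≤ length σ₁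
    p≤ = subst (_≤ length σ₁) (trans length-w₁ u∸1≡p) (length-mono-≤ w₁⊆)
    length-w₂ : length w₂ ≡ q
    length-w₂ = suc-injective (+-cancelˡ-≡ p _ _ (trans (cong (_+ suc (length w₂)) (sym (trans length-w₁ u∸1≡p)))
      (trans (sym (length-++ w₁)) (trans (length-of-red≡π τ red-w) k≡))))
    ℓ+q≤ : suc (length σ₁) + q ≤ p + m + q
    ℓ+q≤ = begin
      suc (length σ₁) + q               ≤⟨ +-monoʳ-≤ (suc (length σ₁)) (subst (_≤ length σ₂) length-w₂ (length-mono-≤ w₂⊆)) ⟩
      suc (length σ₁) + length σ₂       ≡⟨ +-suc (length σ₁) (length σ₂) ⟨
      length σ₁ + suc (length σ₂)       ≡⟨ length-++ σ₁ ⟨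
      length (σ₁ ++ v ∷ σ₂)             ≡⟨ trans length-σ n≡ ⟩
      p + m + q                         ∎
      where open ≤-Reasoning

  inWindow? : Decidable InWindow
  inWindow? = inRange? (suc p) m

  count-inWindow : count inWindow? (interval 1 n) ≡ m
  count-inWindow = subst (λ N → count inWindow? (interval 1 N) ≡ m) (sym n≡) (count-inRange 1 p m q)

  inWindow⇒position : ∀ {ℓ} → InWindow ℓ → ℓ ∈ interval 1 n
  inWindow⇒position (p<ℓ , ℓ<) =
    ∈-interval⁺ 1 n (≤-trans (s≤s z≤n) p<ℓ) (<-≤-trans ℓ< (s≤s (≤-trans (m≤m+n (p + m) q) (≤-reflexive (sym n≡)))))

  module Positions {σ : List ℕ} (length-σ : length σ ≡ n) where

    match⇒inWindow : ∀ {ℓ} → MatchAt τ σ ℓ → InWindow ℓ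
    match⇒inWindow match = occurrence-inWindow length-σ (match⇒occurrence τ match)

    pmp≡count-matches : pmp τ σ ≡ count (matchAt? τ σ) (interval 1 n)
    pmp≡count-matches = trans (pmp≡count τ σ) (cong (λ N → count (matchAt? τ σ) (interval 1 N)) length-σ)

    pmp≤m : pmp τ σ ≤ m
    pmp≤m = subst₂ _≤_ (sym pmp≡count-matches) count-inWindow
      (count-mono (matchAt? τ σ) inWindow? match⇒inWindow (interval 1 n))

    pmp≡m⇒occurrence : pmp τ σ ≡ m → ∀ {ℓ} → InWindow ℓ → Occurrence τ σ ℓ
    pmp≡m⇒occurrence pmp≡m ℓ∈ = match⇒occurrence τ
      (count-≡⇒ (matchAt? τ σ) inWindow? match⇒inWindow
        (trans (sym pmp≡count-matches) (trans pmp≡m (sym count-inWindow))) (inWindow⇒position ℓ∈) ℓ∈)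

    occurrences⇒pmp≡m : (∀ {ℓ} → InWindow ℓ → Occurrence τ σ ℓ) → pmp τ σ ≡ m
    occurrences⇒pmp≡m occurrences = trans pmp≡count-matches (trans (cong length
      (filter-cong-local (matchAt? τ σ) inWindow? {interval 1 n} (λ _ → match⇒inWindow) (λ _ ℓ∈ → occurrence⇒match τ (occurrences ℓ∈))))
      count-inWindow)

  outside⇒∉window : ∀ {x} → Outside x → x ∉ window
  outside⇒∉window (inj₁ x<a)   x∈ = <⇒≱ x<a (proj₁ (∈-window⁻ x∈))
  outside⇒∉window (inj₂ a+d<x) x∈ = <⇒≱ a+d<x (proj₂ (∈-window⁻ x∈))

  window-bounds : ∀ {x} → x ∈ window → 1 ≤ x × x ≤ n
  window-bounds x∈ = let a≤x , x≤a+d = ∈-window⁻ x∈ in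
    ≤-trans (proj₁ a-bounds) a≤x , ≤-trans x≤a+d (≤-trans (+-monoˡ-≤ d (proj₂ a-bounds)) (≤-reflexive k+d≡n))

  expand-bounds : ∀ {v} → 1 ≤ v → v ≤ k → 1 ≤ expand v × expand v ≤ n
  expand-bounds {v} 1≤v v≤k with v <? a
  ... | yes _ = 1≤v , ≤-trans v≤k (≤-trans (m≤m+n k d) (≤-reflexive k+d≡n))
  ... | no  _ = ≤-trans 1≤v (m≤m+n v d) , ≤-trans (+-monoˡ-≤ d v≤k) (≤-reflexive k+d≡n)

  module Sound {M : List ℕ} (M∈ : M ∈ permutations window) where

    M↭window : M ↭ window
    M↭window = ∈-permutations⁻ window M∈

    M⊆window : ∀ {x} → x ∈ M → x ∈ window
    M⊆window = ∈-resp-↭ M↭window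

    length-M : length M ≡ m
    length-M = trans (↭-length M↭window) (length-interval a m)

    length-frame : length (frame M) ≡ n
    length-frame = begin
      length (map expand π₁ ++ M ++ map expand π₂)  ≡⟨ length-++ (map expand π₁) ⟩
      length (map expand π₁) + length (M ++ map expand π₂)
        ≡⟨ cong₂ _+_ (length-map expand π₁) (trans (length-++ M) (cong₂ _+_ length-M (length-map expand π₂))) ⟩
      p + (m + q)                                    ≡⟨ +-assoc p m q ⟨
      p + m + q                                      ≡⟨ n≡ ⟨
      n                                              ∎
      where open ≡-Reasoning

    frame-perm : IsPerm n (frame M)
    frame-perm = perm-intro n frame-unique length-frame frame-bounds
      where
      expand-injective : ∀ {v v′} → expand v ≡ expand v′ → v ≡ v′
      expand-injective = strictMono-injective expand-mono
      π-bounds : ∀ {v} → v ∈ π₁ ++ a ∷ π₂ → 1 ≤ expand v × expand v ≤ n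
      π-bounds v∈ = let 1≤v , v≤k = perm-bounds π-perm′ v∈ in expand-bounds 1≤v v≤k
      M∩π₂ : Disjoint M (map expand π₂)
      M∩π₂ (x∈M , x∈) with ∈-map⁻ expand x∈
      ... | v , v∈π₂ , refl = outside⇒∉window (expand-outside (π₂∌a v∈π₂)) (M⊆window x∈M)
      π₁∩rest : Disjoint (map expand π₁) (M ++ map expand π₂)
      π₁∩rest (x∈ , x∈rest) with ∈-map⁻ expand x∈ | ∈-++⁻ M x∈rest
      ... | v , v∈π₁ , refl | inj₁ x∈M = outside⇒∉window (expand-outside (π₁∌a v∈π₁)) (M⊆window x∈M)
      ... | v , v∈π₁ , refl | inj₂ x∈′ with ∈-map⁻ expand x∈′
      ...   | v′ , v′∈π₂ , eq = π₁∩π₂ (v∈π₁ , subst (_∈ π₂) (sym (expand-injective eq)) v′∈π₂)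
      frame-unique : Unique (frame M)
      frame-unique = Unique.++⁺ (Unique.map⁺ expand-injective π₁-unique)
        (Unique.++⁺ (Unique-resp-↭ (↭⇒↭ₛ (↭-sym M↭window)) (interval-unique a m)) (Unique.map⁺ expand-injective π₂-unique) M∩π₂)
        π₁∩rest
      frame-bounds : ∀ {x} → x ∈ frame M → 1 ≤ x × x ≤ n
      frame-bounds x∈ with ∈-++⁻ (map expand π₁) x∈
      ... | inj₁ x∈₁ with ∈-map⁻ expand x∈₁
      ...   | v , v∈ , refl = π-bounds (∈-++⁺ˡ v∈)
      frame-bounds x∈ | inj₂ x∈rest with ∈-++⁻ M x∈rest
      ... | inj₁ x∈M = window-bounds (M⊆window x∈M)
      ... | inj₂ x∈₂ with ∈-map⁻ expand x∈₂
      ...   | v , v∈ , refl = π-bounds (∈-++⁺ʳ π₁ (there v∈))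

    frame-occurrence : ∀ {ℓ} → InWindow ℓ → Occurrence τ (frame M) ℓ
    frame-occurrence {ℓ} (p<ℓ , ℓ<) with split-around (ℓ ∸ suc p) M i<length-M
      where
      i<length-M : ℓ ∸ suc p < length M
      i<length-M = subst (ℓ ∸ suc p <_) (sym length-M)
        (+-cancelˡ-< (suc p) _ _ (subst (_< suc p + m) (sym (m+[n∸m]≡n p<ℓ)) ℓ<))
    ... | M₁ , x , M₂ , refl , length-M₁ =
      occurrence (map expand π₁ ++ M₁) x (M₂ ++ map expand π₂) (map expand π₁) (map expand π₂)
        (trans (cong (map expand π₁ ++_) (++-assoc M₁ (x ∷ M₂) _)) (sym (++-assoc (map expand π₁) M₁ _)))
        (trans (cong suc (trans (length-++ (map expand π₁)) (cong₂ _+_ (length-map expand π₁) length-M₁))) (m+[n∸m]≡n p<ℓ))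
        (Sublist.++⁺ʳ M₁ ⊆-refl) (Sublist.++⁺ˡ M₂ ⊆-refl)
        (trans (length-map expand π₁) (sym u∸1≡p))
        (let a≤x , x≤a+d = ∈-window⁻ (M⊆window (∈-++⁺ʳ M₁ (here refl))) in red-frame a≤x x≤a+d)

    frame-pmp : pmp τ (frame M) ≡ m
    frame-pmp = Positions.occurrences⇒pmp≡m length-frame frame-occurrence

  n∸[v+d]≡k∸v : ∀ v → n ∸ (v + d) ≡ k ∸ v
  n∸[v+d]≡k∸v v = trans (cong₂ _∸_ (trans (sym k+d≡n) (+-comm k d)) (+-comm v d)) ([m+n]∸[m+o]≡n∸o d k v)

  record Embedding (σ : List ℕ) (x : ℕ) : Set where
    field
      w₁ w₂     : List ℕ
      word⊆σ    : w₁ ++ x ∷ w₂ ⊆ σ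
      length-w₁ : length w₁ ≡ p
      red-word  : red (w₁ ++ x ∷ w₂) ≡ π τ

    word : List ℕ
    word = w₁ ++ x ∷ w₂

    x∈word : x ∈ word
    x∈word = ∈-++⁺ʳ w₁ (here refl)

    ranks : map (rank word) w₁ ≡ π₁ × rank word x ≡ a × map (rank word) w₂ ≡ π₂
    ranks =
      let w₁≡ , rest≡ = ++-injective (map (rank word) w₁) (trans (length-map (rank word) w₁) length-w₁)
                          (trans (sym (map-++ (rank word) w₁ (x ∷ w₂))) (trans red-word π-split))
      in w₁≡ , ∷-injectiveˡ rest≡ , ∷-injectiveʳ rest≡

    rank-x : rank word x ≡ a
    rank-x = proj₁ (proj₂ ranks)

    length-w₂ : length w₂ ≡ q
    length-w₂ = trans (sym (length-map (rank word) w₂)) (cong length (proj₂ (proj₂ ranks)))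

    rank<a⇒<x : ∀ {c} → rank word c < a → c < x
    rank<a⇒<x r<a = rank-reflect word (subst (_ <_) (sym rank-x) r<a)

    <x⇒rank<a : ∀ {c} → c ∈ word → c < x → rank word c < a
    <x⇒rank<a c∈ c<x = subst (_ <_) rank-x (rank-mono word c∈ c<x)

    a<rank⇒x< : ∀ {c} → a < rank word c → x < c
    a<rank⇒x< a<r = rank-reflect word (subst (_< _) (sym rank-x) a<r)

    x<⇒a<rank : ∀ {c} → x < c → a < rank word c
    x<⇒a<rank x<c = subst (_< _) rank-x (rank-mono word x∈word x<c)

    rank∈π : ∀ {c} → c ∈ word → rank word c ∈ π τ
    rank∈π c∈ = subst (_ ∈_) red-word (∈-map⁺ (rank word) c∈)

    above-x : above x word ≡ k ∸ a
    above-x = begin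
      above x word                        ≡⟨ above-rank word x∈word ⟨
      above (rank word x) (red word)      ≡⟨ cong₂ above rank-x red-word ⟩
      above a (π τ)                       ≡⟨ perm-above (π-perm τ) (subst (a ∈_) (sym π-split) (∈-++⁺ʳ π₁ (here refl))) ⟩
      k ∸ a                               ∎
      where open ≡-Reasoning

  low? : Decidable (_< a)
  low? = _<? a

  highπ? : Decidable (a <_)
  highπ? = a <?_

  highσ? : Decidable (a + d <_)
  highσ? = a + d <?_

  module _ {σ : List ℕ} (σ-perm : IsPerm n σ) where

    embedding-bounds : ∀ {x} → Embedding σ x → a ≤ x × x ≤ a + d
    embedding-bounds {x} E = a≤x , x≤a+d
      where
      open Embedding E
      x∈σ : x ∈ σ
      x∈σ = Sublist.Any-resp-⊆ word⊆σ x∈word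
      a∸1≤x∸1 : a ∸ 1 ≤ x ∸ 1
      a∸1≤x∸1 = subst₂ _≤_ (cong (_∸ 1) rank-x) (perm-below σ-perm x∈σ) (count-mono-⊆ (_<? x) word⊆σ)
      a≤x : a ≤ x
      a≤x = subst₂ _≤_ (m+[n∸m]≡n (proj₁ a-bounds)) (m+[n∸m]≡n (proj₁ (perm-bounds σ-perm x∈σ))) (s≤s a∸1≤x∸1)
      x≤a+d : x ≤ a + d
      x≤a+d = ∸-cancelʳ-≤ (proj₂ (perm-bounds σ-perm x∈σ))
        (subst₂ _≤_ (trans above-x (sym (n∸[v+d]≡k∸v a))) (perm-above σ-perm x∈σ) (count-mono-⊆ (x <?_) word⊆σ))

    -- The occurrence through a has a - 1 letters below a, as many as σ has; so it contains
    -- them all, in order, and each of them is its own rank.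
    lows : Embedding σ a → filter low? (π τ) ≡ filter low? σ
    lows E = begin
      filter low? (π τ)                                         ≡⟨ cong (filter low?) red-word ⟨
      filter low? (map (rank word) word)                        ≡⟨ filter-map low? (rank word) word ⟩
      map (rank word) (filter (λ c → rank word c <? a) word)
        ≡⟨ cong (map (rank word)) (filter-cong-local (λ c → rank word c <? a) low? {word} (λ _ → rank<a⇒<x) <x⇒rank<a) ⟩
      map (rank word) (filter low? word)                        ≡⟨ cong (map (rank word)) lows-of-word ⟩
      map (rank word) (filter low? σ)                           ≡⟨ map-id-local (All.tabulate rank-low) ⟩
      filter low? σ                                             ∎
      where
      open ≡-Reasoning
      open Embedding E
      lows-of-word : filter low? word ≡ filter low? σ
      lows-of-word = filter-≡-of-⊆ low? word⊆σ
        (trans (cong (_∸ 1) rank-x) (sym (perm-below σ-perm (Sublist.Any-resp-⊆ word⊆σ x∈word))))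
      rank-low : ∀ {v} → v ∈ filter low? σ → rank word v ≡ v
      rank-low {v} v∈ =
        let v∈σ , v<a = ∈-filter⁻ low? {xs = σ} v∈
        in trans (cong suc (trans (count-≡-of-filter low? {ys = word} {xs = σ} (_<? v) (λ y<v → <-trans y<v v<a) lows-of-word) (perm-below σ-perm v∈σ)))
                 (m+[n∸m]≡n (proj₁ (perm-bounds σ-perm v∈σ)))

    -- Dually, the occurrence through a + d contains all k - a letters of σ above a + d.
    highs : Embedding σ (a + d) → map (_+ d) (filter highπ? (π τ)) ≡ filter highσ? σ
    highs E = begin
      map (_+ d) (filter highπ? (π τ))                                      ≡⟨ cong (map (_+ d) ∘ filter highπ?) red-word ⟨
      map (_+ d) (filter highπ? (map (rank word) word))                     ≡⟨ cong (map (_+ d)) (filter-map highπ? (rank word) word) ⟩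
      map (_+ d) (map (rank word) (filter (λ c → a <? rank word c) word))
        ≡⟨ cong (map (_+ d) ∘ map (rank word)) (filter-cong-local (λ c → a <? rank word c) highσ? {word} (λ _ → a<rank⇒x<) (λ _ → x<⇒a<rank)) ⟩
      map (_+ d) (map (rank word) (filter highσ? word))                     ≡⟨ cong (map (_+ d) ∘ map (rank word)) highs-of-word ⟩
      map (_+ d) (map (rank word) (filter highσ? σ))                        ≡⟨ map-∘ (filter highσ? σ) ⟨
      map (λ c → rank word c + d) (filter highσ? σ)                         ≡⟨ map-id-local (All.tabulate rank-high) ⟩
      filter highσ? σ                                                       ∎
      where
      open ≡-Reasoning
      open Embedding E
      highs-of-word : filter highσ? word ≡ filter highσ? σ
      highs-of-word = filter-≡-of-⊆ highσ? word⊆σ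
        (trans above-x (trans (sym (n∸[v+d]≡k∸v a)) (sym (perm-above σ-perm (Sublist.Any-resp-⊆ word⊆σ x∈word)))))
      rank-high : ∀ {v} → v ∈ filter highσ? σ → rank word v + d ≡ v
      rank-high {v} v∈ = sym (∸-cancelˡ-≡ (proj₂ (perm-bounds σ-perm v∈σ)) r+d≤n n∸v≡n∸[r+d])
        where
        v∈σ : v ∈ σ
        v∈σ = proj₁ (∈-filter⁻ highσ? {xs = σ} v∈)
        v∈word : v ∈ word
        v∈word = proj₁ (∈-filter⁻ highσ? {xs = word} (subst (v ∈_) (sym highs-of-word) v∈))
        r+d≤n : rank word v + d ≤ n
        r+d≤n = ≤-trans (+-monoˡ-≤ d (proj₂ (perm-bounds (π-perm τ) (rank∈π v∈word)))) (≤-reflexive k+d≡n)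
        n∸v≡n∸[r+d] : n ∸ v ≡ n ∸ (rank word v + d)
        n∸v≡n∸[r+d] = begin
          n ∸ v                            ≡⟨ perm-above σ-perm v∈σ ⟨
          above v σ                        ≡⟨ count-≡-of-filter highσ? {ys = word} {xs = σ} (v <?_) (λ v<y → <-trans (proj₂ (∈-filter⁻ highσ? {xs = σ} v∈)) v<y) highs-of-word ⟨
          above v word                     ≡⟨ above-rank word v∈word ⟨
          above (rank word v) (red word)   ≡⟨ cong (above (rank word v)) red-word ⟩
          above (rank word v) (π τ)        ≡⟨ perm-above (π-perm τ) (rank∈π v∈word) ⟩
          k ∸ rank word v                  ≡⟨ n∸[v+d]≡k∸v (rank word v) ⟨
          n ∸ (rank word v + d)            ∎

  module Segment {σ x} (E : Embedding σ x) (a≤x : a ≤ x) (x≤a+d : x ≤ a + d) {C πC : List ℕ}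
    (C⊆word : ∀ {c} → c ∈ C → c ∈ Embedding.word E) (C-outside : ∀ {c} → c ∈ C → Outside c)
    (ranks-C : map (rank (Embedding.word E)) C ≡ πC) where

    open Embedding E

    rank-lows : map (rank word) (filter low? C) ≡ filter low? πC
    rank-lows = sym (begin
      filter low? πC                                      ≡⟨ cong (filter low?) ranks-C ⟨
      filter low? (map (rank word) C)                     ≡⟨ filter-map low? (rank word) C ⟩
      map (rank word) (filter (λ c → rank word c <? a) C)
        ≡⟨ cong (map (rank word)) (filter-cong-local (λ c → rank word c <? a) low? {C} rank<a⇒low low⇒rank<a) ⟩
      map (rank word) (filter low? C)                     ∎)
      where
      open ≡-Reasoning
      low⇒rank<a : ∀ {c} → c ∈ C → c < a → rank word c < a
      low⇒rank<a c∈ c<a = <x⇒rank<a (C⊆word c∈) (<-≤-trans c<a a≤x)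
      rank<a⇒low : ∀ {c} → c ∈ C → rank word c < a → c < a
      rank<a⇒low c∈ r<a with C-outside c∈
      ... | inj₁ c<a   = c<a
      ... | inj₂ a+d<c = contradiction (≤-<-trans x≤a+d a+d<c) (<⇒≯ (rank<a⇒<x r<a))

    rank-highs : map (rank word) (filter highσ? C) ≡ filter highπ? πC
    rank-highs = sym (begin
      filter highπ? πC                                     ≡⟨ cong (filter highπ?) ranks-C ⟨
      filter highπ? (map (rank word) C)                    ≡⟨ filter-map highπ? (rank word) C ⟩
      map (rank word) (filter (λ c → a <? rank word c) C)
        ≡⟨ cong (map (rank word)) (filter-cong-local (λ c → a <? rank word c) highσ? {C} a<rank⇒high (λ _ a+d<c → x<⇒a<rank (≤-<-trans x≤a+d a+d<c))) ⟩
      map (rank word) (filter highσ? C)                    ∎)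
      where
      open ≡-Reasoning
      a<rank⇒high : ∀ {c} → c ∈ C → a < rank word c → a + d < c
      a<rank⇒high c∈ a<r with C-outside c∈
      ... | inj₁ c<a   = contradiction (<-≤-trans c<a a≤x) (<⇒≯ (a<rank⇒x< a<r))
      ... | inj₂ a+d<c = a+d<c

    segment≡expand : filter low? C ≡ filter low? πC → filter highσ? C ≡ map (_+ d) (filter highπ? πC) → C ≡ map expand πC
    segment≡expand lows-C highs-C = begin
      C                                  ≡⟨ map-id-local (All.tabulate expand-rank) ⟨
      map (λ c → expand (rank word c)) C ≡⟨ map-∘ C ⟩
      map expand (map (rank word) C)     ≡⟨ cong (map expand) ranks-C ⟩
      map expand πC                      ∎
      where
      open ≡-Reasoning
      expand-rank : ∀ {c} → c ∈ C → expand (rank word c) ≡ c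
      expand-rank c∈ with C-outside c∈
      ... | inj₁ c<a = trans (expand-low (<x⇒rank<a (C⊆word c∈) (<-≤-trans c<a a≤x)))
        (map-≡-id⇒ (rank word) (trans rank-lows (sym lows-C)) (∈-filter⁺ low? c∈ c<a))
      ... | inj₂ a+d<c = trans (expand-high (<⇒≯ (x<⇒a<rank (≤-<-trans x≤a+d a+d<c))))
        (map-≡-id⇒ (λ c → rank word c + d) (trans (map-∘ (filter highσ? C)) (trans (cong (map (_+ d)) rank-highs) (sym highs-C)))
          (∈-filter⁺ highσ? c∈ a+d<c))

  module Complete (A M B : List ℕ) (σ-perm : IsPerm n (A ++ M ++ B)) (pmp≡m : pmp τ (A ++ M ++ B) ≡ m)
    (length-A : length A ≡ p) (length-M : length M ≡ m) where

    σ : List ℕ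
    σ = A ++ M ++ B

    length-B : length B ≡ q
    length-B = +-cancelˡ-≡ m _ _ (+-cancelˡ-≡ p _ _ (begin
      p + (m + length B)                 ≡⟨ cong₂ (λ i j → i + (j + length B)) length-A length-M ⟨
      length A + (length M + length B)   ≡⟨ cong (length A +_) (length-++ M) ⟨
      length A + length (M ++ B)         ≡⟨ length-++ A ⟨
      length σ                           ≡⟨ trans (perm-length σ-perm) n≡ ⟩
      p + m + q                          ≡⟨ +-assoc p m q ⟩
      p + (m + q)                        ∎))
      where open ≡-Reasoning

    -- Opaque, so that type checking never unfolds the decision procedure hidden in pmp.
    opaque
      embedding-at : ∀ M₁ {x} M₂ → M ≡ M₁ ++ x ∷ M₂ →
        Σ (Embedding σ x) λ E → Embedding.w₁ E ⊆ A ++ M₁ × Embedding.w₂ E ⊆ M₂ ++ B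
      embedding-at M₁ {x} M₂ M≡ with Positions.pmp≡m⇒occurrence (perm-length σ-perm) pmp≡m inWindow
        where
        |M₁|<m : length M₁ < m
        |M₁|<m = subst (length M₁ <_) (trans (sym (length-++ M₁)) (trans (cong length (sym M≡)) length-M)) (m<m+n (length M₁) z<s)
        inWindow : InWindow (suc (p + length M₁))
        inWindow = s≤s (m≤m+n p (length M₁)) , s≤s (+-monoʳ-< p |M₁|<m)
      ... | occurrence before v after w₁ w₂ σ≡ position w₁⊆ w₂⊆ length-w₁ red-w
        with ++-injective before {xs₂ = A ++ M₁} length-before (trans (sym σ≡) σ≡′)
        where
        length-before : length before ≡ length (A ++ M₁)
        length-before = trans (suc-injective position) (sym (trans (length-++ A) (cong (_+ length M₁) length-A)))
        σ≡′ : σ ≡ (A ++ M₁) ++ x ∷ (M₂ ++ B)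
        σ≡′ = trans (cong (λ M′ → A ++ M′ ++ B) M≡) (trans (cong (A ++_) (++-assoc M₁ (x ∷ M₂) B)) (sym (++-assoc A M₁ _)))
      ... | refl , refl = record
        { w₁ = w₁ ; w₂ = w₂
        ; word⊆σ = subst (_ ⊆_) (sym σ≡) (Sublist.++⁺ w₁⊆ (refl ∷ w₂⊆))
        ; length-w₁ = trans length-w₁ u∸1≡p
        ; red-word = red-w
        } , w₁⊆ , w₂⊆

    embedding-through : ∀ {x} → x ∈ M → Embedding σ x
    embedding-through x∈ = let M₁ , M₂ , M≡ = ∈-∃++ x∈ in proj₁ (embedding-at M₁ M₂ M≡)

    M⊆window : ∀ {x} → x ∈ M → x ∈ window
    M⊆window x∈ = let a≤x , x≤a+d = embedding-bounds σ-perm (embedding-through x∈) in ∈-window⁺ a≤x x≤a+d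

    σ-parts : Unique A × Unique (M ++ B) × Disjoint A (M ++ B)
    σ-parts = Unique-++⁻ A (perm-unique σ-perm)

    M-parts : Unique M × Unique B × Disjoint M B
    M-parts = Unique-++⁻ M (proj₁ (proj₂ σ-parts))

    M↭window : M ↭ window
    M↭window = ↭-of-⊆ M (proj₁ M-parts) (trans length-M (sym (length-interval a m))) M⊆window

    window⊆M : ∀ {x} → x ∈ window → x ∈ M
    window⊆M = ∈-resp-↭ (↭-sym M↭window)

    outside-M : ∀ {c} → c ∉ M → Outside c
    outside-M {c} c∉M with c <? a | a + d <? c
    ... | yes c<a | _            = inj₁ c<a
    ... | no  _   | yes a+d<c    = inj₂ a+d<c
    ... | no  c≮a | no  a+d≮c    = contradiction (window⊆M (∈-window⁺ (≮⇒≥ c≮a) (≮⇒≥ a+d≮c))) c∉M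

    A-outside : ∀ {c} → c ∈ A → Outside c
    A-outside c∈A = outside-M (λ c∈M → proj₂ (proj₂ σ-parts) (c∈A , ∈-++⁺ˡ c∈M))

    B-outside : ∀ {c} → c ∈ B → Outside c
    B-outside c∈B = outside-M (λ c∈M → proj₂ (proj₂ M-parts) (c∈M , c∈B))

    through-first : ∃ λ x → Σ (Embedding σ x) λ E → Embedding.w₁ E ≡ A
    through-first with split-around 0 M (subst (0 <_) (sym (trans length-M (+-comm d 1))) z<s)
    ... | [] , x , M₂ , M≡ , _ with embedding-at [] M₂ M≡
    ...   | E , w₁⊆ , _ = x , E ,
            ⊆-length-≡ (subst (_ ⊆_) (++-identityʳ A) w₁⊆) (trans (Embedding.length-w₁ E) (sym length-A))

    through-last : ∃ λ x → Σ (Embedding σ x) λ E → Embedding.w₂ E ≡ B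
    through-last with split-around d M (subst (d <_) (sym (trans length-M (+-comm d 1))) ≤-refl)
    ... | M₁ , x , [] , M≡ , _ with embedding-at M₁ [] M≡
    ...   | E , _ , w₂⊆ = x , E ,
            ⊆-length-≡ w₂⊆ (trans (Embedding.length-w₂ E) (sym length-B))
    through-last | M₁ , x , y ∷ M₂ , M≡ , length-M₁ with +-cancelˡ-≡ d 1 (suc (suc (length M₂)))
      (trans (sym length-M) (trans (cong length M≡) (trans (length-++ M₁) (cong (_+ _) length-M₁))))
    ... | ()

    E-first : Embedding σ (proj₁ through-first)
    E-first = proj₁ (proj₂ through-first)

    E-last : Embedding σ (proj₁ through-last)
    E-last = proj₁ (proj₂ through-last)

    module SegmentA = Segment E-first (proj₁ (embedding-bounds σ-perm E-first)) (proj₂ (embedding-bounds σ-perm E-first))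
      {A} {π₁} (λ c∈ → ∈-++⁺ˡ (subst (_ ∈_) (sym (proj₂ (proj₂ through-first))) c∈)) A-outside
      (subst (λ C → map (rank (Embedding.word E-first)) C ≡ π₁) (proj₂ (proj₂ through-first)) (proj₁ (Embedding.ranks E-first)))

    module SegmentB = Segment E-last (proj₁ (embedding-bounds σ-perm E-last)) (proj₂ (embedding-bounds σ-perm E-last))
      {B} {π₂} (λ c∈ → ∈-++⁺ʳ (Embedding.w₁ E-last) (there (subst (_ ∈_) (sym (proj₂ (proj₂ through-last))) c∈))) B-outside
      (subst (λ C → map (rank (Embedding.word E-last)) C ≡ π₂) (proj₂ (proj₂ through-last)) (proj₂ (proj₂ (Embedding.ranks E-last))))

    lows-split : filter low? π₁ ≡ filter low? A × filter low? π₂ ≡ filter low? B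
    lows-split = ++-injective (filter low? π₁) count-lows (begin
      filter low? π₁ ++ filter low? π₂                 ≡⟨ cong (filter low? π₁ ++_) (filter-reject low? (<-irrefl refl)) ⟨
      filter low? π₁ ++ filter low? (a ∷ π₂)           ≡⟨ filter-++ low? π₁ (a ∷ π₂) ⟨
      filter low? (π₁ ++ a ∷ π₂)                      ≡⟨ cong (filter low?) π-split ⟨
      filter low? (π τ)                               ≡⟨ lows σ-perm (embedding-through (window⊆M (∈-window⁺ ≤-refl (m≤m+n a d)))) ⟩
      filter low? σ                                   ≡⟨ filter-++ low? A (M ++ B) ⟩
      filter low? A ++ filter low? (M ++ B)            ≡⟨ cong (filter low? A ++_) (filter-++ low? M B) ⟩
      filter low? A ++ filter low? M ++ filter low? B   ≡⟨ cong (λ L → filter low? A ++ L ++ filter low? B) (filter-none low? (All.tabulate M-not-low)) ⟩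
      filter low? A ++ filter low? B                   ∎)
      where
      open ≡-Reasoning
      count-lows : count low? π₁ ≡ count low? A
      count-lows = trans (cong length (sym SegmentA.rank-lows)) (length-map _ (filter low? A))
      M-not-low : ∀ {x} → x ∈ M → ¬ x < a
      M-not-low x∈ = ≤⇒≯ (proj₁ (∈-window⁻ (M⊆window x∈)))

    highs-split : map (_+ d) (filter highπ? π₁) ≡ filter highσ? A × map (_+ d) (filter highπ? π₂) ≡ filter highσ? B
    highs-split = ++-injective (map (_+ d) (filter highπ? π₁)) count-highs (begin
      map (_+ d) (filter highπ? π₁) ++ map (_+ d) (filter highπ? π₂)        ≡⟨ cong (λ L → map (_+ d) (filter highπ? π₁) ++ map (_+ d) L) (filter-reject highπ? (<-irrefl refl)) ⟨
      map (_+ d) (filter highπ? π₁) ++ map (_+ d) (filter highπ? (a ∷ π₂))  ≡⟨ map-++ (_+ d) (filter highπ? π₁) _ ⟨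
      map (_+ d) (filter highπ? π₁ ++ filter highπ? (a ∷ π₂))               ≡⟨ cong (map (_+ d)) (filter-++ highπ? π₁ (a ∷ π₂)) ⟨
      map (_+ d) (filter highπ? (π₁ ++ a ∷ π₂))                           ≡⟨ cong (map (_+ d) ∘ filter highπ?) π-split ⟨
      map (_+ d) (filter highπ? (π τ))                                    ≡⟨ highs σ-perm (embedding-through (window⊆M (∈-window⁺ (m≤m+n a d) ≤-refl))) ⟩
      filter highσ? σ                                                     ≡⟨ filter-++ highσ? A (M ++ B) ⟩
      filter highσ? A ++ filter highσ? (M ++ B)                             ≡⟨ cong (filter highσ? A ++_) (filter-++ highσ? M B) ⟩
      filter highσ? A ++ filter highσ? M ++ filter highσ? B                   ≡⟨ cong (λ L → filter highσ? A ++ L ++ filter highσ? B) (filter-none highσ? (All.tabulate M-not-high)) ⟩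
      filter highσ? A ++ filter highσ? B                                    ∎)
      where
      open ≡-Reasoning
      count-highs : length (map (_+ d) (filter highπ? π₁)) ≡ count highσ? A
      count-highs = trans (length-map (_+ d) (filter highπ? π₁)) (trans (cong length (sym SegmentA.rank-highs)) (length-map _ (filter highσ? A)))
      M-not-high : ∀ {x} → x ∈ M → ¬ a + d < x
      M-not-high x∈ = ≤⇒≯ (proj₂ (∈-window⁻ (M⊆window x∈)))

    σ∈candidates : σ ∈ candidates
    σ∈candidates = subst (_∈ candidates)
      (cong₂ (λ A′ B′ → A′ ++ M ++ B′)
        (sym (SegmentA.segment≡expand (sym (proj₁ lows-split)) (sym (proj₁ highs-split))))
        (sym (SegmentB.segment≡expand (sym (proj₂ lows-split)) (sym (proj₂ highs-split)))))
      (∈-map⁺ frame (∈-permutations⁺ window M↭window))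

  no-contribution-above : ∀ j → m < j → ∀ σ → ¬ Contributes n τ j σ
  no-contribution-above j m<j σ (σ-perm , pmp≡j) =
    <⇒≱ m<j (subst (_≤ m) pmp≡j (Positions.pmp≤m {σ} (perm-length σ-perm)))

  candidates-correct : ∀ σ → σ ∈ candidates ⇔ Contributes n τ m σ
  candidates-correct σ = mk⇔ sound complete
    where
    sound : σ ∈ candidates → Contributes n τ m σ
    sound σ∈ with ∈-map⁻ frame σ∈
    ... | M , M∈ , refl = Sound.frame-perm M∈ , Sound.frame-pmp M∈

    complete : Contributes n τ m σ → σ ∈ candidates
    complete (σ-perm , pmp≡m) with split-at p σ (subst (p ≤_) (sym (trans (perm-length σ-perm) n≡)) (≤-trans (m≤m+n p m) (m≤m+n (p + m) q)))
    ... | A , R , refl , length-A with split-at m R (subst (m ≤_) (sym length-R) (m≤m+n m q))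
      where
      length-R : length R ≡ m + q
      length-R = +-cancelˡ-≡ p _ _ (trans (cong (_+ length R) (sym length-A))
        (trans (sym (length-++ A)) (trans (trans (perm-length σ-perm) n≡) (+-assoc p m q))))
    ... | M , B , refl , length-M = Complete.σ∈candidates A M B σ-perm pmp≡m length-A length-M

marked-split : ∀ {k} (τ : MarkedPattern k) → ∃₂ λ π₁ a → ∃ λ π₂ → π τ ≡ π₁ ++ a ∷ π₂ × u τ ≡ suc (length π₁)
marked-split τ with split-around (u τ ∸ 1) (π τ) u∸1<length
  where
  u∸1<length : u τ ∸ 1 < length (π τ)
  u∸1<length = subst (u τ ∸ 1 <_) (sym (perm-length (π-perm τ))) (≤-trans (≤-reflexive (m+[n∸m]≡n (1≤u τ))) (u≤k τ))
... | π₁ , a , π₂ , π≡ , length-π₁ = π₁ , a , π₂ , π≡ , trans (sym (m+[n∸m]≡n (1≤u τ))) (cong suc (sym length-π₁))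

theorem5 : (n k : ℕ) → 1 ≤ k → k ≤ n → (τ : MarkedPattern k) →
    ((j : ℕ) → (n ∸ k) + 1 < j → (σ : List ℕ) → ¬ Contributes n τ j σ)
    × Σ (List (List ℕ)) (λ L → Unique L
        × ((σ : List ℕ) → (σ ∈ L) ⇔ Contributes n τ ((n ∸ k) + 1) σ)
        × length L ≡ ((n ∸ k) + 1) !)
theorem5 n k _ k≤n τ =
  let π₁ , a , π₂ , π≡ , u≡ = marked-split τ
      open LeadingTerm τ π₁ a π₂ n (n ∸ k) π≡ u≡ (m+[n∸m]≡n k≤n)
  in no-contribution-above , candidates , candidates-unique , candidates-correct , length-candidates
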